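{- Let $Q$ be the quiver with two vertices $v_1,v_2$ and exactly two arrows from $v_1$ to $v_2$, and let $\boldsymbol b=(b_1,b_2)$ be an admissible vector for $Q$. Then $b_1=-b_2\le 0$.
   Context: Given a quiver $Q$ on mutable vertices $v_1,\dots,v_n$ (no loops, no 2-cycles) and an integer vector $\boldsymbol b=(b_1,\dots,b_n)$, add a frozen vertex $q$ with $b_i$ arrows from $v_i$ to $q$ (negative meaning arrows from $q$ to $v_i$). Mutation $\mu_k$ of the corresponding exchange matrix: $b'_{ij}=-b_{ij}$ if $k\in\{i,j\}$, otherwise $b'_{ij}=b_{ij}+\mathrm{sgn}(b_{ik})[b_{ik}b_{kj}]_+$; mutations are allowed only at $v_1,\dots,v_n$. The vector $\boldsymbol b$ is admissible if $\boldsymbol b\ne0$ and the quiver with frozen vertex $q$ has finite mutation class. -}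

module Defs where

open import Data.Nat using (ℕ; zero; suc)
open import Data.Integer using (ℤ; +_; +[1+_]; -[1+_]; -_; _+_; _*_; _⊔_; 0ℤ; 1ℤ)
open import Data.Fin using (Fin; zero; suc; _≟_)
open import Data.Vec using (Vec; []; _∷_; lookup; tabulate; replicate)
open import Data.List using (List; []; _∷_; map)
open import Data.List.Membership.Propositional using (_∈_)
open import Data.Bool using (if_then_else_; _∨_)
open import Data.Product using (Σ; _×_)
open import Relation.Nullary using (¬_; does)
open import Relation.Binary.PropositionalEquality using (_≡_)

Mat : ℕ → Set
Mat n = Vec (Vec ℤ n) n

entry : ∀ {n} → Mat n → Fin n → Fin n → ℤ
entry M i j = lookup (lookup M i) j

sgn : ℤ → ℤ
sgn (+ zero)   = 0ℤ
sgn +[1+ _ ]   = 1ℤ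
sgn -[1+ _ ]   = - 1ℤ

pos : ℤ → ℤ
pos x = x ⊔ 0ℤ

mutate : ∀ {n} → Fin n → Mat n → Mat n
mutate k M = tabulate λ i → tabulate λ j →
  if does (i ≟ k) ∨ does (j ≟ k)
  then - entry M i j
  else entry M i j + sgn (entry M i k) * pos (entry M i k * entry M k j)

mutateSeq : ∀ {n} → List (Fin n) → Mat n → Mat n
mutateSeq []       M = M
mutateSeq (k ∷ ks) M = mutateSeq ks (mutate k M)

-- Extended exchange matrix: index zero is the frozen vertex q,
-- index (suc i) is the mutable vertex v_{i+1}.
-- b_{v_i, q} = b_i (b_i arrows v_i → q), b_{q, v_i} = - b_i.
extend : ∀ {n} → Mat n → Vec ℤ n → Mat (suc n)
extend {n} Q b = tabulate e
  where
  e : Fin (suc n) → Vec ℤ (suc n)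
  e zero    = 0ℤ ∷ tabulate (λ j → - lookup b j)
  e (suc i) = lookup b i ∷ tabulate (λ j → entry Q i j)

FiniteMutationClass : ∀ {n} → Mat (suc n) → Set
FiniteMutationClass {n} B =
  Σ (List (Mat (suc n))) λ L → (ks : List (Fin n)) → mutateSeq (map suc ks) B ∈ L

Admissible : ∀ {n} → Mat n → Vec ℤ n → Set
Admissible {n} Q b = (¬ b ≡ replicate n 0ℤ) × FiniteMutationClass (extend Q b)

-- Kronecker quiver: two arrows v_1 → v_2, so b_12 = 2, b_21 = -2.
kronecker : Mat 2
kronecker = (0ℤ ∷ + 2 ∷ []) ∷ (- (+ 2) ∷ 0ℤ ∷ []) ∷ []

-- Mutating alternately at v₁ and v₂ acts on the frozen row (x, y) = (b_{q v₁}, b_{q v₂})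
-- of the extended exchange matrix by (x, y) ↦ (x + 2|s|, y − 2|s|), where s = x + y,
-- as soon as x ≥ 0 and s ≠ 0 (mutating first at v₁ if s > 0, first at v₂ if s < 0).
-- Then the entry b_{q v₁} grows without bound, contradicting finiteness of the mutation
-- class. Hence x ≥ 0 forces s = 0; and x < 0 is impossible as well, because one round
-- of mutations at v₁, v₂ makes x non-negative and s positive. With x = −b₁ and y = −b₂
-- this says b₁ = −b₂ ≤ 0.
module Submission where

open import Defs
open import Data.Nat as ℕ using (ℕ; zero; suc)
import Data.Nat.Properties as ℕₚ
open import Data.Nat.ListAction using (sum)
open import Data.Integer
  using (ℤ; +_; +[1+_]; -[1+_]; -_; _+_; _-_; _*_; ∣_∣; 0ℤ; 1ℤ; _≤_; _<_; +≤+; -≤+; +<+; nonNegative)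
open import Data.Integer.Properties
open import Algebra.Properties.AbelianGroup +-0-abelianGroup using (inverseʳ-unique)
open import Data.Integer.Tactic.RingSolver using (solve-∀)
open import Data.Fin using (Fin; zero; suc)
open import Data.Vec using ([]; _∷_)
open import Data.List using (List; []; _∷_; _++_; map; concat; replicate)
open import Data.List.Properties using (map-++)
open import Data.List.Membership.Propositional using (_∈_)
open import Data.List.Membership.Propositional.Properties using (∈-map⁺)
open import Data.List.Relation.Unary.Any using (here; there)
open import Data.Product using (∃₂; _×_; _,_; proj₁; proj₂)
open import Data.Empty using (⊥-elim)
open import Function using (_∘_)
open import Relation.Binary.Definitions using (tri<; tri≈; tri>)
open import Relation.Nullary using (¬_; yes; no)
open import Relation.Binary.PropositionalEquality
  using (_≡_; refl; sym; trans; cong; subst; subst₂; module ≡-Reasoning)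

private
  variable
    A : Set
    n : ℕ
    M : Mat n
    x y : ℤ

∈⇒≤sum : ∀ {m ms} → m ∈ ms → m ℕ.≤ sum ms
∈⇒≤sum {ms = m ∷ ms} (here refl)  = ℕₚ.m≤m+n m (sum ms)
∈⇒≤sum {ms = m ∷ ms} (there m∈ms) = ℕₚ.≤-trans (∈⇒≤sum m∈ms) (ℕₚ.m≤n+m (sum ms) m)

+≤⇒≤∣∣ : ∀ {k z} → + k ≤ z → k ℕ.≤ ∣ z ∣
+≤⇒≤∣∣ (+≤+ k≤z) = k≤z

0<i⇒0<i*2 : ∀ {s} → 0ℤ < s → 0ℤ < s * + 2
0<i⇒0<i*2 {+[1+ k ]} _        = +<+ ℕ.z<s
0<i⇒0<i*2 {+ zero}   (+<+ ())

unbounded⇒⊈ : (E : A → ℤ) (f : ℕ → A) → (∀ k → + k ≤ E (f k)) →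
              (L : List A) → ¬ (∀ k → f k ∈ L)
unbounded⇒⊈ E f unbounded L f⊆L = ℕₚ.<-irrefl refl (ℕₚ.≤-<-trans bound≤ (<bound (f⊆L bound)))
  where
  bound : ℕ
  bound = suc (sum (map (∣_∣ ∘ E) L))
  bound≤ : bound ℕ.≤ ∣ E (f bound) ∣
  bound≤ = +≤⇒≤∣∣ (unbounded bound)
  <bound : f bound ∈ L → ∣ E (f bound) ∣ ℕ.< bound
  <bound = ℕ.s≤s ∘ ∈⇒≤sum ∘ ∈-map⁺ (∣_∣ ∘ E)

mutateMutable : List (Fin n) → Mat (suc n) → Mat (suc n)
mutateMutable ks = mutateSeq (map suc ks)

mutateSeq-++ : ∀ (ks ls : List (Fin n)) (M : Mat n) →
               mutateSeq (ks ++ ls) M ≡ mutateSeq ls (mutateSeq ks M)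
mutateSeq-++ []       ls M = refl
mutateSeq-++ (k ∷ ks) ls M = mutateSeq-++ ks ls (mutate k M)

mutateMutable-++ : ∀ (ks ls : List (Fin n)) (M : Mat (suc n)) →
                   mutateMutable (ks ++ ls) M ≡ mutateMutable ls (mutateMutable ks M)
mutateMutable-++ ks ls M = trans (cong (λ js → mutateSeq js M) (map-++ suc ks ls))
                                 (mutateSeq-++ (map suc ks) (map suc ls) M)

finite-mutateMutable : ∀ (ks : List (Fin n)) → FiniteMutationClass M →
                       FiniteMutationClass (mutateMutable ks M)
finite-mutateMutable {M = M} ks (L , reachable) =
  L , λ ls → subst (_∈ L) (mutateMutable-++ ks ls M) (reachable (ks ++ ls))

repeat : ℕ → List A → List A
repeat k w = concat (replicate k w)

module _ (E : Mat (suc n) → ℤ) (P : Mat (suc n) → Set) (w : List (Fin n))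
         (pump : ∀ {M} → P M → P (mutateMutable w M) × E M < E (mutateMutable w M))
         where

  pumped-grows : ∀ k {M} → P M → E M + + k ≤ E (mutateMutable (repeat k w) M)
  pumped-grows zero    {M} _  = ≤-reflexive (+-identityʳ (E M))
  pumped-grows (suc k) {M} pM with pump pM
  ... | pM′ , EM<EM′ = begin
    E M + + suc k                              ≡⟨ shift (E M) (+ k) ⟩
    1ℤ + E M + + k                             ≤⟨ +-monoˡ-≤ (+ k) (i<j⇒suc[i]≤j EM<EM′) ⟩
    E M′ + + k                                 ≤⟨ pumped-grows k pM′ ⟩
    E (mutateMutable (repeat k w) M′)          ≡⟨ cong E (mutateMutable-++ w (repeat k w) M) ⟨
    E (mutateMutable (repeat (suc k) w) M)     ∎
    where
    open ≤-Reasoning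
    M′ = mutateMutable w M
    shift : ∀ i j → i + (1ℤ + j) ≡ 1ℤ + i + j
    shift = solve-∀

  pumped⇒¬finite : ∀ {M} → P M → 0ℤ ≤ E M → ¬ FiniteMutationClass M
  pumped⇒¬finite {M} pM 0≤EM (L , reachable) =
    unbounded⇒⊈ E (λ k → mutateMutable (repeat k w) M)
      (λ k → ≤-trans (i≤j+i (+ k) (E M) {{nonNegative 0≤EM}}) (pumped-grows k pM))
      L (λ k → reachable (repeat k w))

q v₁ v₂ : Fin 3
q  = zero
v₁ = suc zero
v₂ = suc (suc zero)

frozenEntry₁ : Mat 3 → ℤ
frozenEntry₁ M = entry M q v₁

μ₁μ₂ μ₂μ₁ : List (Fin 2)
μ₁μ₂ = zero ∷ suc zero ∷ []
μ₂μ₁ = suc zero ∷ zero ∷ []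

-- Mutation at v₁ or v₂ changes the frozen row and the Kronecker block only through
-- each other, so it suffices to track these four entries.
record KroneckerShape (M : Mat 3) (x y : ℤ) : Set where
  constructor shape
  field
    frozen₁  : entry M q v₁ ≡ x
    frozen₂  : entry M q v₂ ≡ y
    arrows₁₂ : entry M v₁ v₂ ≡ + 2
    arrows₂₁ : entry M v₂ v₁ ≡ - + 2

open KroneckerShape

extend-shape : ∀ b₁ b₂ → KroneckerShape (extend kronecker (b₁ ∷ b₂ ∷ [])) (- b₁) (- b₂)
extend-shape b₁ b₂ = shape refl refl refl refl

shape-cong : ∀ {x′ y′} → x ≡ x′ → y ≡ y′ → KroneckerShape M x y → KroneckerShape M x′ y′
shape-cong refl refl s = s

increment : ℤ → ℤ → ℤ
increment a b = sgn a * pos (a * b)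

increment-nonneg-+2 : ∀ {a} → 0ℤ ≤ a → increment a (+ 2) ≡ a * + 2
increment-nonneg-+2 {+ zero}   _ = refl
increment-nonneg-+2 {+[1+ a ]} _ = *-identityˡ _

increment-neg-+2 : ∀ {a} → a < 0ℤ → increment a (+ 2) ≡ 0ℤ
increment-neg-+2 { -[1+ a ]} _        = refl
increment-neg-+2 { + a }     (+<+ ())

increment-neg--2 : ∀ {a} → a < 0ℤ → increment a (- + 2) ≡ a * + 2
increment-neg--2 { -[1+ a ]} _        = -1*i≡-i _
increment-neg--2 { + a }     (+<+ ())

increment-+2-bounds : ∀ a → 0ℤ ≤ increment a (+ 2) × a ≤ increment a (+ 2)
increment-+2-bounds (+ k)      = subst (λ i → 0ℤ ≤ i × + k ≤ i) (sym (increment-nonneg-+2 0≤k)) (0≤2k , k≤2k)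
  where
  0≤k : 0ℤ ≤ + k
  0≤k = +≤+ ℕ.z≤n
  2k≡ : ∀ a → a * + 2 ≡ a + a
  2k≡ = solve-∀
  0≤2k : 0ℤ ≤ + k * + 2
  0≤2k = subst (0ℤ ≤_) (sym (2k≡ (+ k))) (+-mono-≤ 0≤k 0≤k)
  k≤2k : + k ≤ + k * + 2
  k≤2k = subst (+ k ≤_) (sym (2k≡ (+ k))) (i≤i+j (+ k) (+ k))
increment-+2-bounds -[1+ k ] = +≤+ ℕ.z≤n , -≤+

shape-μ₁μ₂ : KroneckerShape M x y →
  KroneckerShape (mutateMutable μ₁μ₂ M)
    (- x + increment (y + increment x (+ 2)) (+ 2)) (- (y + increment x (+ 2)))
shape-μ₁μ₂ (shape refl refl b₁₂ b₂₁) rewrite b₁₂ | b₂₁ = shape refl refl refl refl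

shape-μ₂μ₁ : KroneckerShape M x y →
  KroneckerShape (mutateMutable μ₂μ₁ M)
    (- (x + increment y (- + 2))) (- y + increment (x + increment y (- + 2)) (- + 2))
shape-μ₂μ₁ (shape refl refl b₁₂ b₂₁) rewrite b₁₂ | b₂₁ = shape refl refl refl refl

FrozenRow : (ℤ → Set) → Mat 3 → Set
FrozenRow S M = ∃₂ λ x y → KroneckerShape M x y × 0ℤ ≤ x × S (x + y)

Rising Falling : Mat 3 → Set
Rising  = FrozenRow (0ℤ <_)
Falling = FrozenRow (_< 0ℤ)

frozenRow-nonneg : ∀ {S M} → FrozenRow S M → 0ℤ ≤ frozenEntry₁ M
frozenRow-nonneg (x , y , s , 0≤x , _) = subst (0ℤ ≤_) (sym (frozen₁ s)) 0≤x

shape-pump₁₂ : KroneckerShape M x y → 0ℤ ≤ x → 0ℤ < x + y →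
  KroneckerShape (mutateMutable μ₁μ₂ M) (x + (x + y) * + 2) (y - (x + y) * + 2)
shape-pump₁₂ {x = x} {y} s 0≤x 0<s = shape-cong x′≡ y′≡ (shape-μ₁μ₂ s)
  where
  open ≡-Reasoning
  y+2x≡ : ∀ x y → y + x * + 2 ≡ (x + y) + x
  y+2x≡ = solve-∀
  x′-identity : ∀ x y → - x + (y + x * + 2) * + 2 ≡ x + (x + y) * + 2
  x′-identity = solve-∀
  y′-identity : ∀ x y → - (y + x * + 2) ≡ y - (x + y) * + 2
  y′-identity = solve-∀
  0≤y+2x : 0ℤ ≤ y + x * + 2
  0≤y+2x = subst (0ℤ ≤_) (sym (y+2x≡ x y)) (<⇒≤ (+-mono-<-≤ 0<s 0≤x))
  x′≡ : - x + increment (y + increment x (+ 2)) (+ 2) ≡ x + (x + y) * + 2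
  x′≡ = begin
    - x + increment (y + increment x (+ 2)) (+ 2) ≡⟨ cong (λ i → - x + increment (y + i) (+ 2)) (increment-nonneg-+2 0≤x) ⟩
    - x + increment (y + x * + 2) (+ 2)           ≡⟨ cong (λ i → - x + i) (increment-nonneg-+2 0≤y+2x) ⟩
    - x + (y + x * + 2) * + 2                     ≡⟨ x′-identity x y ⟩
    x + (x + y) * + 2                             ∎
  y′≡ : - (y + increment x (+ 2)) ≡ y - (x + y) * + 2
  y′≡ = begin
    - (y + increment x (+ 2)) ≡⟨ cong (λ i → - (y + i)) (increment-nonneg-+2 0≤x) ⟩
    - (y + x * + 2)           ≡⟨ y′-identity x y ⟩
    y - (x + y) * + 2         ∎

shape-pump₂₁ : KroneckerShape M x y → 0ℤ ≤ x → x + y < 0ℤ →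
  KroneckerShape (mutateMutable μ₂μ₁ M) (x + (- (x + y)) * + 2) (y - (- (x + y)) * + 2)
shape-pump₂₁ {x = x} {y} s 0≤x s<0 = shape-cong x′≡ y′≡ (shape-μ₂μ₁ s)
  where
  open ≡-Reasoning
  x+2y≡ : ∀ x y → x + y * + 2 ≡ (x + y) + y
  x+2y≡ = solve-∀
  x′-identity : ∀ x y → - (x + y * + 2) ≡ x + (- (x + y)) * + 2
  x′-identity = solve-∀
  y′-identity : ∀ x y → - y + (x + y * + 2) * + 2 ≡ y - (- (x + y)) * + 2
  y′-identity = solve-∀
  y<0 : y < 0ℤ
  y<0 = ≤-<-trans (i≤j+i y x {{nonNegative 0≤x}}) s<0
  x+2y<0 : x + y * + 2 < 0ℤ
  x+2y<0 = subst (_< 0ℤ) (sym (x+2y≡ x y)) (+-mono-< s<0 y<0)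
  x′≡ : - (x + increment y (- + 2)) ≡ x + (- (x + y)) * + 2
  x′≡ = begin
    - (x + increment y (- + 2)) ≡⟨ cong (λ i → - (x + i)) (increment-neg--2 y<0) ⟩
    - (x + y * + 2)             ≡⟨ x′-identity x y ⟩
    x + (- (x + y)) * + 2       ∎
  y′≡ : - y + increment (x + increment y (- + 2)) (- + 2) ≡ y - (- (x + y)) * + 2
  y′≡ = begin
    - y + increment (x + increment y (- + 2)) (- + 2) ≡⟨ cong (λ i → - y + increment (x + i) (- + 2)) (increment-neg--2 y<0) ⟩
    - y + increment (x + y * + 2) (- + 2)             ≡⟨ cong (λ i → - y + i) (increment-neg--2 x+2y<0) ⟩
    - y + (x + y * + 2) * + 2                         ≡⟨ y′-identity x y ⟩
    y - (- (x + y)) * + 2                             ∎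

frozenRow-shift : ∀ {S : ℤ → Set} {M M′ d} → KroneckerShape M x y → 0ℤ ≤ x → S (x + y) →
                  0ℤ < d → KroneckerShape M′ (x + d) (y - d) →
                  FrozenRow S M′ × frozenEntry₁ M < frozenEntry₁ M′
frozenRow-shift {x = x} {y} {S} {d = d} s 0≤x Sx+y 0<d s′ =
  (x + d , y - d , s′ , +-mono-≤ 0≤x (<⇒≤ 0<d) , subst S (sum-shift x y d) Sx+y) ,
  subst₂ _<_ (sym (frozen₁ s)) (sym (frozen₁ s′))
         (subst (_< x + d) (+-identityʳ x) (+-monoʳ-< x 0<d))
  where
  sum-shift : ∀ x y d → x + y ≡ (x + d) + (y - d)
  sum-shift = solve-∀

rising-pumps : Rising M → Rising (mutateMutable μ₁μ₂ M) × frozenEntry₁ M < frozenEntry₁ (mutateMutable μ₁μ₂ M)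
rising-pumps (x , y , s , 0≤x , 0<s) =
  frozenRow-shift {S = 0ℤ <_} s 0≤x 0<s (0<i⇒0<i*2 0<s) (shape-pump₁₂ s 0≤x 0<s)

falling-pumps : Falling M → Falling (mutateMutable μ₂μ₁ M) × frozenEntry₁ M < frozenEntry₁ (mutateMutable μ₂μ₁ M)
falling-pumps (x , y , s , 0≤x , s<0) =
  frozenRow-shift {S = _< 0ℤ} s 0≤x s<0 (0<i⇒0<i*2 (neg-mono-< s<0)) (shape-pump₂₁ s 0≤x s<0)

¬finite-rising : Rising M → ¬ FiniteMutationClass M
¬finite-rising r =
  pumped⇒¬finite frozenEntry₁ Rising μ₁μ₂ rising-pumps r (frozenRow-nonneg {S = 0ℤ <_} r)

¬finite-falling : Falling M → ¬ FiniteMutationClass M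
¬finite-falling f =
  pumped⇒¬finite frozenEntry₁ Falling μ₂μ₁ falling-pumps f (frozenRow-nonneg {S = _< 0ℤ} f)

negative-rises : KroneckerShape M x y → x < 0ℤ → Rising (mutateMutable μ₁μ₂ M)
negative-rises {x = x} {y} s x<0 =
  - x + increment y (+ 2) , - y , shape-cong x′≡ y′≡ (shape-μ₁μ₂ s) ,
  +-mono-≤ (<⇒≤ 0<-x) 0≤inc ,
  subst (0ℤ <_) (sym (+-assoc (- x) (increment y (+ 2)) (- y))) (+-mono-<-≤ 0<-x (i≤j⇒0≤j-i y≤inc))
  where
  0<-x : 0ℤ < - x
  0<-x = neg-mono-< x<0
  y+0≡y : y + increment x (+ 2) ≡ y
  y+0≡y = trans (cong (λ i → y + i) (increment-neg-+2 x<0)) (+-identityʳ y)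
  x′≡ : - x + increment (y + increment x (+ 2)) (+ 2) ≡ - x + increment y (+ 2)
  x′≡ = cong (λ i → - x + increment i (+ 2)) y+0≡y
  y′≡ : - (y + increment x (+ 2)) ≡ - y
  y′≡ = cong -_ y+0≡y
  0≤inc : 0ℤ ≤ increment y (+ 2)
  0≤inc = proj₁ (increment-+2-bounds y)
  y≤inc : y ≤ increment y (+ 2)
  y≤inc = proj₂ (increment-+2-bounds y)

sum-zero : KroneckerShape M x y → 0ℤ ≤ x → FiniteMutationClass M → x + y ≡ 0ℤ
sum-zero {x = x} {y} s 0≤x finite with <-cmp (x + y) 0ℤ
... | tri< s<0 _ _ = ⊥-elim (¬finite-falling (x , y , s , 0≤x , s<0) finite)
... | tri≈ _ s≡0 _ = s≡0
... | tri> _ _ 0<s = ⊥-elim (¬finite-rising (x , y , s , 0≤x , 0<s) finite)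

frozen₁-nonneg : KroneckerShape M x y → FiniteMutationClass M → 0ℤ ≤ x
frozen₁-nonneg {x = x} s finite with 0ℤ ≤? x
... | yes 0≤x = 0≤x
... | no  0≰x = ⊥-elim (¬finite-rising (negative-rises s (≰⇒> 0≰x)) (finite-mutateMutable μ₁μ₂ finite))

corollary3p5 : (b₁ b₂ : ℤ) → Admissible kronecker (b₁ ∷ b₂ ∷ []) →
    (b₁ ≡ - b₂) × (b₁ ≤ 0ℤ)
corollary3p5 b₁ b₂ (_ , finite) = b₁≡-b₂ , neg-cancel-≤ 0≤-b₁
  where
  s : KroneckerShape (extend kronecker (b₁ ∷ b₂ ∷ [])) (- b₁) (- b₂)
  s = extend-shape b₁ b₂
  0≤-b₁ : 0ℤ ≤ - b₁
  0≤-b₁ = frozen₁-nonneg s finite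
  b₁≡-b₂ : b₁ ≡ - b₂
  b₁≡-b₂ = begin
    b₁     ≡⟨ neg-involutive b₁ ⟨
    - - b₁ ≡⟨ inverseʳ-unique (- b₁) (- b₂) (sum-zero s 0≤-b₁ finite) ⟨
    - b₂   ∎
    where open ≡-Reasoning
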